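{- Let $M=(I,O,T,t_0,\tau,\mathit{out})$ be a Moore system, $\Phi$ a CTL* formula over inputs $I$ and outputs $O$, and $\mathcal A=(2^O,2^I,Q,q_0,\delta,\mathit{Acc})$ an alternating hesitant tree automaton corresponding to $\Phi$ (accepting exactly the computation trees satisfying $\Phi$). Then $M\models\Phi$ if and only if the following SMT query (over uninterpreted $\mathit{rch}:Q\times T\to\{\mathit{true},\mathit{false}\}$ and $\rho:Q\times T\to\mathbb N_0$) is satisfiable: $$\mathit{rch}(q_0,t_0)\wedge\bigwedge_{(q,t)\in Q\times T}\Big(\mathit{rch}(q,t)\rightarrow\delta(q,\mathit{out}(t))\big[(d,q')\mapsto\mathit{rch}(q',\tau(t,d))\wedge\rho(q,t)\triangleright_{q,q'}\rho(q',\tau(t,d))\big]\Big),$$ where $\delta(q,\mathit{out}(t))[(d,q')\mapsto\cdots]$ denotes the positive Boolean formula $\delta(q,\mathit{out}(t))$ with every atom $(d,q')$ substituted as indicated, and $\rho(q,t)\triangleright_{q,q'}\rho(q',t')$ is: if $q,q'$ lie in the same set $Q^N_i$, then $\mathit{true}$ when $q\in\mathit{Acc}$ and $\rho(q,t)>\rho(q',t')$ otherwise; if $q,q'$ lie in the same set $Q^U_i$, then $\rho(q,t)>\rho(q',t')$ when $q\in\mathit{Acc}$ and $\rho(q,t)\ge\rho(q',t')$ otherwise; and $\mathit{true}$ in all other cases.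
   Context: Moore system: finite states $T$, initial $t_0$, total $\tau:T\times2^I\to T$, $\mathit{out}:T\to2^O$; its computation tree has nodes $n\in(2^I)^*$ labelled $\mathit{out}(\tau(t_0,n))$, and $M\models\Phi$ means this tree satisfies $\Phi$ (CTL* in which input literals are path formulas: a path $n_1n_2\dots$ with $n_2=n_1\cdot e$ satisfies $i\in I$ iff $i\in e$). For a finite set $S$, $\mathcal B^+(S)$ denotes positive Boolean formulas over $S$ (excluding $\mathit{true},\mathit{false}$). An alternating hesitant tree automaton $(2^O,2^I,Q,q_0,\delta:Q\times2^O\to\mathcal B^+(2^I\times Q),\mathit{Acc}\subseteq Q)$ is one whose states are partitioned into sets $Q^N_1,\dots,Q^N_{k_N}$ ("nondeterministic") and $Q^U_1,\dots,Q^U_{k_U}$ ("universal") with a partial order on these sets, such that for $q\in Q^N_i$ the formula $\delta(q,a)$ contains only disjunctively related elements of $Q^N_i$ and all its other atoms' states belong to lower sets, and for $q\in Q^U_i$ it contains only conjunctively related elements of $Q^U_i$ and all other atoms' states belong to lower sets. A run-tree path (state sequence) is accepting iff it eventually stays in some $Q^U_i$ and visits $\mathit{Acc}\cap Q^U$ finitely often, or eventually stays in some $Q^N_i$ and visits $\mathit{Acc}\cap Q^N$ infinitely often; a tree is accepted iff there is a run-tree all of whose paths are accepting (run-trees are defined as usual: from a node labelled $\sigma$ in state $q$, choose a set of atoms satisfying $\delta(q,\sigma)$ and send a copy in state $q'$ into direction $d$ for each chosen $(d,q')$). -}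

module Defs where

open import Level using (0ℓ)
open import Data.Nat using (ℕ; zero; suc; _+_; _<_; _≤_; _>_; _≥_)
open import Data.Bool using (Bool; true; false)
open import Data.Fin using (Fin) renaming (_≟_ to _≟ᶠ_)
open import Data.Fin.Subset using (Subset) renaming (_∈_ to _∈ˢ_)
open import Data.List using (List; []; _∷_; _++_; _∷ʳ_)
open import Data.List.Membership.Propositional using () renaming (_∈_ to _∈ᴸ_)
open import Data.List.Relation.Unary.Any using (Any)
open import Data.List.Relation.Unary.All using (All)
open import Data.Product using (Σ; ∃; _×_; _,_)
open import Data.Sum using (_⊎_)
open import Data.Unit using (⊤)
open import Data.Empty using (⊥)
open import Relation.Nullary using (¬_; yes; no)
open import Relation.Binary using (Rel; IsStrictPartialOrder)
open import Relation.Binary.PropositionalEquality using (_≡_; _≢_)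

-- Inputs I = Fin nI, outputs O = Fin nO; letters 2^I and 2^O are subsets.

Letter : ℕ → Set
Letter nI = Subset nI

record Moore (nI nO nT : ℕ) : Set where
  field
    t₀  : Fin nT
    τ   : Fin nT → Subset nI → Fin nT
    out : Fin nT → Subset nO

-- τ extended to finite words (first letter read first)
τ* : ∀ {nI nO nT} → Moore nI nO nT → Fin nT → List (Subset nI) → Fin nT
τ* M t []      = t
τ* M t (d ∷ w) = τ* M (Moore.τ M t d) w

-- 2^O-labelled 2^I-trees: nodes are words in (2^I)*
Tree : ℕ → ℕ → Set
Tree nI nO = List (Subset nI) → Subset nO

compTree : ∀ {nI nO nT} → Moore nI nO nT → Tree nI nO
compTree M n = Moore.out M (τ* M (Moore.t₀ M) n)

mutual
  data SF (nI nO : ℕ) : Set where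
    tt    : SF nI nO
    outp  : Fin nO → SF nI nO
    ¬ₛ_   : SF nI nO → SF nI nO
    _∧ₛ_  : SF nI nO → SF nI nO → SF nI nO
    E     : PF nI nO → SF nI nO        -- A φ := ¬ E ¬ φ

  data PF (nI nO : ℕ) : Set where
    st    : SF nI nO → PF nI nO
    inp   : Fin nI → PF nI nO
    ¬ₚ_   : PF nI nO → PF nI nO
    _∧ₚ_  : PF nI nO → PF nI nO → PF nI nO
    X     : PF nI nO → PF nI nO
    _U_   : PF nI nO → PF nI nO → PF nI nO

prefix : ∀ {A : Set} → ℕ → (ℕ → A) → List A
prefix zero    e = []
prefix (suc k) e = e 0 ∷ prefix k (λ j → e (suc j))

-- A path starting at node n is given by n and its sequence of directions
-- e (so the path is n, n·e 0, n·e 0·e 1, ...).  Its k-th suffix starts at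
-- node n ++ prefix k e with directions λ j → e (k + j).
mutual
  ⟦_⟧ˢ : ∀ {nI nO} → SF nI nO → Tree nI nO → List (Subset nI) → Set
  ⟦ tt ⟧ˢ     tr n = ⊤
  ⟦ outp o ⟧ˢ tr n = o ∈ˢ tr n
  ⟦ ¬ₛ φ ⟧ˢ   tr n = ¬ (⟦ φ ⟧ˢ tr n)
  ⟦ φ ∧ₛ ψ ⟧ˢ tr n = ⟦ φ ⟧ˢ tr n × ⟦ ψ ⟧ˢ tr n
  ⟦ E φ ⟧ˢ    tr n = Σ (ℕ → Subset _) λ e → ⟦ φ ⟧ᵖ tr n e

  ⟦_⟧ᵖ : ∀ {nI nO} → PF nI nO → Tree nI nO → List (Subset nI) → (ℕ → Subset nI) → Set
  ⟦ st φ ⟧ᵖ   tr n e = ⟦ φ ⟧ˢ tr n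
  ⟦ inp i ⟧ᵖ  tr n e = i ∈ˢ e 0
  ⟦ ¬ₚ φ ⟧ᵖ   tr n e = ¬ (⟦ φ ⟧ᵖ tr n e)
  ⟦ φ ∧ₚ ψ ⟧ᵖ tr n e = ⟦ φ ⟧ᵖ tr n e × ⟦ ψ ⟧ᵖ tr n e
  ⟦ X φ ⟧ᵖ    tr n e = ⟦ φ ⟧ᵖ tr (n ++ prefix 1 e) (λ j → e (1 + j))
  ⟦ φ U ψ ⟧ᵖ  tr n e =
    Σ ℕ λ k → ⟦ ψ ⟧ᵖ tr (n ++ prefix k e) (λ j → e (k + j))
            × (∀ j → j < k → ⟦ φ ⟧ᵖ tr (n ++ prefix j e) (λ i → e (j + i)))

_⊨_ : ∀ {nI nO} → Tree nI nO → SF nI nO → Set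
tr ⊨ Φ = ⟦ Φ ⟧ˢ tr []

data PBF (S : Set) : Set where
  atom : S → PBF S
  _∧ᵇ_ : PBF S → PBF S → PBF S
  _∨ᵇ_ : PBF S → PBF S → PBF S

⟦_⟧ᵇ : ∀ {S : Set} → PBF S → (S → Set) → Set
⟦ atom s ⟧ᵇ v = v s
⟦ φ ∧ᵇ ψ ⟧ᵇ v = ⟦ φ ⟧ᵇ v × ⟦ ψ ⟧ᵇ v
⟦ φ ∨ᵇ ψ ⟧ᵇ v = ⟦ φ ⟧ᵇ v ⊎ ⟦ ψ ⟧ᵇ v

atoms : ∀ {S : Set} → PBF S → List S
atoms (atom s) = s ∷ []
atoms (φ ∧ᵇ ψ) = atoms φ ++ atoms ψ
atoms (φ ∨ᵇ ψ) = atoms φ ++ atoms ψ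

data Kind : Set where
  N U : Kind

module _ {nI nQ k : ℕ} (part : Fin nQ → Fin k) (_≺_ : Rel (Fin k) 0ℓ) (i : Fin k) where

  NoAtomIn : PBF (Subset nI × Fin nQ) → Set
  NoAtomIn φ = All (λ { (d , q′) → part q′ ≢ i }) (atoms φ)

  -- every atom's state is in set i or in a lower set, and the elements of
  -- set i are only disjunctively (N) / conjunctively (U) related
  HesN : PBF (Subset nI × Fin nQ) → Set
  HesN (atom (d , q′)) = part q′ ≡ i ⊎ part q′ ≺ i
  HesN (φ ∨ᵇ ψ) = HesN φ × HesN ψ
  HesN (φ ∧ᵇ ψ) = HesN φ × HesN ψ × (NoAtomIn φ ⊎ NoAtomIn ψ)

  HesU : PBF (Subset nI × Fin nQ) → Set
  HesU (atom (d , q′)) = part q′ ≡ i ⊎ part q′ ≺ i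
  HesU (φ ∧ᵇ ψ) = HesU φ × HesU ψ
  HesU (φ ∨ᵇ ψ) = HesU φ × HesU ψ × (NoAtomIn φ ⊎ NoAtomIn ψ)

  Hes : Kind → PBF (Subset nI × Fin nQ) → Set
  Hes N = HesN
  Hes U = HesU

-- Alternating hesitant tree automata (2^O, 2^I, Q = Fin nQ, q₀, δ, Acc)
-- The states are partitioned into sets Q₀,…,Q_{k-1} (set of q is part q),
-- each of kind N or U, partially ordered by the strict order _≺_.

record AHTA (nI nO nQ : ℕ) : Set₁ where
  field
    q₀     : Fin nQ
    δ      : Fin nQ → Subset nO → PBF (Subset nI × Fin nQ)
    acc    : Fin nQ → Bool
    k      : ℕ
    part   : Fin nQ → Fin k
    kind   : Fin k → Kind
    _≺_    : Rel (Fin k) 0ℓ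
    ≺-spo  : IsStrictPartialOrder _≡_ _≺_
    hesitant : ∀ q a → Hes part _≺_ (part q) (kind (part q)) (δ q a)

module _ {nI nO nQ : ℕ} (A : AHTA nI nO nQ) where
  open AHTA A

  AccSeq : (ℕ → Fin nQ) → Set
  AccSeq s =
      (Σ (Fin k) λ i → kind i ≡ U × Σ ℕ λ m → (∀ j → m ≤ j → part (s j) ≡ i))
        × (Σ ℕ λ m → ∀ j → m ≤ j → ¬ (acc (s j) ≡ true × kind (part (s j)) ≡ U))
    ⊎ (Σ (Fin k) λ i → kind i ≡ N × Σ ℕ λ m → (∀ j → m ≤ j → part (s j) ≡ i))
        × (∀ m → Σ ℕ λ j → m ≤ j × acc (s j) ≡ true × kind (part (s j)) ≡ N)

  -- run-trees of A on a tree tr: run nodes of an arbitrary type R, each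
  -- labelled with a tree node and a state; the labels of the children of a
  -- run node form the chosen set of atoms, which must satisfy δ.
  record RunTree (tr : Tree nI nO) : Set₁ where
    field
      R        : Set
      root     : R
      node     : R → List (Subset nI)
      state    : R → Fin nQ
      children : R → List R
      root-node  : node root ≡ []
      root-state : state root ≡ q₀
      child-dir  : ∀ x c → c ∈ᴸ children x → Σ (Subset nI) λ d → node c ≡ node x ∷ʳ d
      sat        : ∀ x → ⟦ δ (state x) (tr (node x)) ⟧ᵇ
                           (λ { (d , q′) → Any (λ c → node c ≡ node x ∷ʳ d × state c ≡ q′) (children x) })

    IsPath : (ℕ → R) → Set
    IsPath π = π 0 ≡ root × (∀ j → π (suc j) ∈ᴸ children (π j))

  Accepts : Tree nI nO → Set₁
  Accepts tr = Σ (RunTree tr) λ ρ →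
    ∀ π → RunTree.IsPath ρ π → AccSeq (λ j → RunTree.state ρ (π j))

  rankCond : Fin nQ → Fin nQ → ℕ → ℕ → Set
  rankCond q q′ r r′ with part q ≟ᶠ part q′
  ... | no _ = ⊤
  ... | yes _ with kind (part q) | acc q
  ...   | N | true  = ⊤
  ...   | N | false = r > r′
  ...   | U | true  = r > r′
  ...   | U | false = r ≥ r′

SMTSat : ∀ {nI nO nT nQ} → Moore nI nO nT → AHTA nI nO nQ → Set
SMTSat {nI} {nO} {nT} {nQ} M A =
  Σ (Fin nQ → Fin nT → Bool) λ rch →
  Σ (Fin nQ → Fin nT → ℕ) λ ρ →
    rch (AHTA.q₀ A) (Moore.t₀ M) ≡ true
  × (∀ q t → rch q t ≡ true →
       ⟦ AHTA.δ A q (Moore.out M t) ⟧ᵇ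
         (λ { (d , q′) → rch q′ (Moore.τ M t d) ≡ true
                        × rankCond A q q′ (ρ q t) (ρ q′ (Moore.τ M t d)) }))

module Submission where

-- As A accepts exactly the trees satisfying Φ, it suffices to show that A
-- accepts the computation tree of M iff the query has a solution (rch, ρ).
--
-- Soundness (solution ⇒ run): run nodes are pairs (tree node, state) with rch true, and
-- children are the atoms chosen by the query.  Along every path the sets of the hesitant
-- partition never increase, so they stabilise, and then ρ bounds the visits to Acc in a
-- universal set, resp. forces Acc infinitely often in a nondeterministic set.
--
-- Completeness (run ⇒ solution, classically): rch marks the positions (q,t) occupied by
-- reachable run nodes.  In a nondeterministic set ρ(q,t) is the least n such that a run
-- node at (q,t) reaches Acc within n steps inside its set; in a universal set it is the
-- least co-Büchi rank of (q,t), defined as a nested fixed point over positions.  Both ranks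
-- exist by König-style arguments: a node without rank spawns an infinite path violating
-- the acceptance condition.

open import Defs hiding (_U_)
open import Level using (Level; 0ℓ)
open import Axiom.ExcludedMiddle using (ExcludedMiddle)
open import Data.Nat using (ℕ; zero; suc; _+_; _∸_; _≤_; _<_; _>_; _≥_; _≤′_; ≤′-refl; ≤′-step; z≤n; _⊔_)
open import Data.Nat.Properties
open import Data.Nat.Induction using (<-wellFounded)
open import Data.Bool using (Bool; true; false)
open import Data.Bool.Properties using (¬-not)
open import Data.Fin using (Fin) renaming (_≟_ to _≟ᶠ_)
open import Data.Fin.Subset using (Subset)
open import Data.Fin.Induction using (spo-wellFounded)
open import Data.List using (List; []; _∷_; _++_; _∷ʳ_; map; allFin; cartesianProduct)
open import Data.List.Membership.Propositional using (find; lose) renaming (_∈_ to _∈ᴸ_)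
open import Data.List.Membership.Propositional.Properties using (∈-map⁻; ∈-allFin; ∈-cartesianProduct⁺)
open import Data.List.Relation.Unary.Any using (Any; here; there) renaming (map to Any-map)
import Data.List.Relation.Unary.Any.Properties as Any
open import Data.List.Relation.Unary.All using (All; []; _∷_)
import Data.List.Relation.Unary.All.Properties as All
open import Data.Product using (Σ; _×_; _,_; proj₁; proj₂)
open import Data.Sum using (_⊎_; inj₁; inj₂; [_,_]′)
open import Data.Unit using (⊤; tt)
open import Data.Empty using (⊥; ⊥-elim)
open import Relation.Nullary using (¬_; yes; no; Dec; does)
open import Relation.Nullary.Decidable using (dec-true; decidable-stable)
open import Relation.Binary using (Rel; IsStrictPartialOrder)
open import Relation.Binary.PropositionalEquality
open import Induction.WellFounded using (Acc) renaming (acc to acc-intro)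
open import Function.Base using (case_of_)
open import Function.Bundles using (_⇔_; mk⇔; Equivalence)

module _ {S : Set} where

  ⟦⟧ᵇ-mono : {V V′ : S → Set} (φ : PBF S) → (∀ s → V s → V′ s) → ⟦ φ ⟧ᵇ V → ⟦ φ ⟧ᵇ V′
  ⟦⟧ᵇ-mono (atom s) f v = f s v
  ⟦⟧ᵇ-mono (φ ∧ᵇ ψ) f (v , w) = ⟦⟧ᵇ-mono φ f v , ⟦⟧ᵇ-mono ψ f w
  ⟦⟧ᵇ-mono (φ ∨ᵇ ψ) f (inj₁ v) = inj₁ (⟦⟧ᵇ-mono φ f v)
  ⟦⟧ᵇ-mono (φ ∨ᵇ ψ) f (inj₂ w) = inj₂ (⟦⟧ᵇ-mono ψ f w)

  ⟦⟧ᵇ-restrict : {V H : S → Set} (φ : PBF S) → All H (atoms φ) → ⟦ φ ⟧ᵇ V → ⟦ φ ⟧ᵇ (λ s → V s × H s)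
  ⟦⟧ᵇ-restrict (atom s) (h ∷ []) v = v , h
  ⟦⟧ᵇ-restrict (φ ∧ᵇ ψ) hs (v , w) =
    ⟦⟧ᵇ-restrict φ (All.++⁻ˡ (atoms φ) hs) v , ⟦⟧ᵇ-restrict ψ (All.++⁻ʳ (atoms φ) hs) w
  ⟦⟧ᵇ-restrict (φ ∨ᵇ ψ) hs (inj₁ v) = inj₁ (⟦⟧ᵇ-restrict φ (All.++⁻ˡ (atoms φ) hs) v)
  ⟦⟧ᵇ-restrict (φ ∨ᵇ ψ) hs (inj₂ w) = inj₂ (⟦⟧ᵇ-restrict ψ (All.++⁻ʳ (atoms φ) hs) w)

  chosen : {V : S → Set} (φ : PBF S) → ⟦ φ ⟧ᵇ V → List (Σ S V)
  chosen (atom s) v = (s , v) ∷ []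
  chosen (φ ∧ᵇ ψ) (v , w) = chosen φ v ++ chosen ψ w
  chosen (φ ∨ᵇ ψ) (inj₁ v) = chosen φ v
  chosen (φ ∨ᵇ ψ) (inj₂ w) = chosen ψ w

  chosen-sat : {V : S → Set} (φ : PBF S) (v : ⟦ φ ⟧ᵇ V) →
               ⟦ φ ⟧ᵇ (λ s → Any (λ c → proj₁ c ≡ s) (chosen φ v))
  chosen-sat (atom s) v = here refl
  chosen-sat (φ ∧ᵇ ψ) (v , w) =
    ⟦⟧ᵇ-mono φ (λ _ → Any.++⁺ˡ) (chosen-sat φ v) ,
    ⟦⟧ᵇ-mono ψ (λ _ → Any.++⁺ʳ (chosen φ v)) (chosen-sat ψ w)
  chosen-sat (φ ∨ᵇ ψ) (inj₁ v) = inj₁ (chosen-sat φ v)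
  chosen-sat (φ ∨ᵇ ψ) (inj₂ w) = inj₂ (chosen-sat ψ w)

module _ {nI nQ k : ℕ} (part : Fin nQ → Fin k) (_≺_ : Rel (Fin k) 0ℓ) (i : Fin k) where

  SameOrLower : Subset nI × Fin nQ → Set
  SameOrLower (d , q′) = part q′ ≡ i ⊎ part q′ ≺ i

  hesN-atoms : ∀ φ → HesN part _≺_ i φ → All SameOrLower (atoms φ)
  hesN-atoms (atom _) h = h ∷ []
  hesN-atoms (φ ∧ᵇ ψ) (h , h′ , _) = All.++⁺ (hesN-atoms φ h) (hesN-atoms ψ h′)
  hesN-atoms (φ ∨ᵇ ψ) (h , h′) = All.++⁺ (hesN-atoms φ h) (hesN-atoms ψ h′)

  hesU-atoms : ∀ φ → HesU part _≺_ i φ → All SameOrLower (atoms φ)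
  hesU-atoms (atom _) h = h ∷ []
  hesU-atoms (φ ∧ᵇ ψ) (h , h′) = All.++⁺ (hesU-atoms φ h) (hesU-atoms ψ h′)
  hesU-atoms (φ ∨ᵇ ψ) (h , h′ , _) = All.++⁺ (hesU-atoms φ h) (hesU-atoms ψ h′)

  hes-atoms : ∀ κ φ → Hes part _≺_ i κ φ → All SameOrLower (atoms φ)
  hes-atoms N = hesN-atoms
  hes-atoms U = hesU-atoms

Eventually : (ℕ → Set) → Set
Eventually P = Σ ℕ λ m → ∀ j → m ≤ j → P j

InfinitelyOften : (ℕ → Set) → Set
InfinitelyOften P = ∀ m → Σ ℕ λ j → m ≤ j × P j

no-infinite-descent : (f : ℕ → ℕ) → ¬ Eventually (λ j → Σ ℕ λ j′ → j ≤ j′ × f j′ < f j)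
no-infinite-descent f (m , drop) = go m ≤-refl (<-wellFounded (f m))
  where
  go : ∀ j → m ≤ j → Acc _<_ (f j) → ⊥
  go j m≤j (acc-intro rs) with drop j m≤j
  ... | j′ , j≤j′ , fj′<fj = go j′ (≤-trans m≤j j≤j′) (rs fj′<fj)

module Classical (em : ExcludedMiddle 0ℓ) where

  holds : Set → Bool
  holds P = does (em {P})

  holds-sound : ∀ {P} → holds P ≡ true → P
  holds-sound {P} h with em {P}
  ... | yes p = p

  holds-complete : ∀ {P} → P → holds P ≡ true
  holds-complete p = dec-true em p

  least : (P : ℕ → Set) → Σ ℕ P → Σ ℕ λ m → P m × ∀ n → P n → m ≤ n
  least P (n , p) = go n n ≤-refl p
    where
    go : ∀ b n → n ≤ b → P n → Σ ℕ λ m → P m × ∀ n → P n → m ≤ n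
    go zero .zero z≤n p = zero , p , λ _ _ → z≤n
    go (suc b) n n≤1+b p with em {Σ ℕ λ m → m ≤ b × P m}
    ... | yes (m , m≤b , pm) = go b m m≤b pm
    ... | no none = n , p , λ m pm → ≮⇒≥ λ m<n → none (m , ≤-pred (≤-trans m<n n≤1+b) , pm)

  private
    minimum-of : (P : ℕ → Set) → Dec (Σ ℕ P) → ℕ
    minimum-of P (yes ex) = proj₁ (least P ex)
    minimum-of P (no _)   = 0

  -- The least n with P n, or 0 if there is none.
  minimum : (ℕ → Set) → ℕ
  minimum P = minimum-of P em

  minimum-holds : ∀ P → Σ ℕ P → P (minimum P)
  minimum-holds P ex = holds-at em
    where
    holds-at : (d : Dec (Σ ℕ P)) → P (minimum-of P d)
    holds-at (yes ex′) = proj₁ (proj₂ (least P ex′))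
    holds-at (no none) = ⊥-elim (none ex)

  minimum-≤ : ∀ P n → P n → minimum P ≤ n
  minimum-≤ P n p = below em
    where
    below : (d : Dec (Σ ℕ P)) → minimum-of P d ≤ n
    below (yes ex) = proj₂ (proj₂ (least P ex)) n p
    below (no none) = ⊥-elim (none (n , p))

  infinitely-often : ∀ {P : ℕ → Set} → ¬ Eventually (λ j → ¬ P j) → InfinitelyOften P
  infinitely-often {P} notEv m with em {Σ ℕ λ j → m ≤ j × P j}
  ... | yes found = found
  ... | no none = ⊥-elim (notEv (m , λ j m≤j pj → none (j , m≤j , pj)))

  finitely-many-drops : (f : ℕ → ℕ) (P : ℕ → Set) (m : ℕ) →
    (∀ j → m ≤ j → f (suc j) ≤ f j) → (∀ j → m ≤ j → P j → f (suc j) < f j) →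
    Eventually (λ j → ¬ P j)
  finitely-many-drops f P m noninc drop with em {Eventually (λ j → ¬ P j)}
  ... | yes ev = ev
  ... | no notEv = ⊥-elim (no-infinite-descent f (m , descent))
    where
    noninc-≤′ : ∀ {j j′} → m ≤ j → j ≤′ j′ → f j′ ≤ f j
    noninc-≤′ m≤j ≤′-refl = ≤-refl
    noninc-≤′ m≤j (≤′-step j≤′j′) = ≤-trans (noninc _ (≤-trans m≤j (≤′⇒≤ j≤′j′))) (noninc-≤′ m≤j j≤′j′)
    descent : ∀ j → m ≤ j → Σ ℕ λ j′ → j ≤ j′ × f j′ < f j
    descent j m≤j with infinitely-often notEv j
    ... | j′ , j≤j′ , pj′ = suc j′ , m≤n⇒m≤1+n j≤j′ ,
          <-≤-trans (drop j′ (≤-trans m≤j j≤j′) pj′) (noninc-≤′ m≤j (≤⇒≤′ j≤j′))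

  infinitely-many-rests : (f : ℕ → ℕ) (P : ℕ → Set) (m : ℕ) →
    (∀ j → m ≤ j → ¬ P j → f (suc j) < f j) → InfinitelyOften P
  infinitely-many-rests f P m drop = infinitely-often λ { (m′ , notP) →
    no-infinite-descent f (m ⊔ m′ , λ j le → suc j , n≤1+n j ,
      drop j (≤-trans (m≤m⊔n m m′) le) (notP j (≤-trans (m≤n⊔m m m′) le))) }

  module _ {k : ℕ} {_≺_ : Rel (Fin k) 0ℓ} (spo : IsStrictPartialOrder _≡_ _≺_) where

    Descending : (ℕ → Fin k) → Set
    Descending p = ∀ j → p (suc j) ≡ p j ⊎ p (suc j) ≺ p j

    descending-≤′ : ∀ {p} → Descending p → ∀ {j j′} → j ≤′ j′ → p j′ ≡ p j ⊎ p j′ ≺ p j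
    descending-≤′ desc ≤′-refl = inj₁ refl
    descending-≤′ {p} desc {j} (≤′-step {n} j≤′n) with desc n | descending-≤′ desc j≤′n
    ... | inj₁ e | inj₁ e′ = inj₁ (trans e e′)
    ... | inj₁ e | inj₂ l′ = inj₂ (subst (_≺ p j) (sym e) l′)
    ... | inj₂ l | inj₁ e′ = inj₂ (subst (p (suc n) ≺_) e′ l)
    ... | inj₂ l | inj₂ l′ = inj₂ (IsStrictPartialOrder.trans spo l l′)

    eventually-constant : ∀ p → Descending p → Σ (Fin k) λ i → Eventually (λ j → p j ≡ i)
    eventually-constant p desc = go (p 0) (spo-wellFounded spo (p 0)) 0 refl
      where
      go : ∀ x → Acc _≺_ x → ∀ j → p j ≡ x → Σ (Fin k) λ i → Eventually (λ j → p j ≡ i)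
      go x (acc-intro rs) j pj≡x with em {Σ ℕ λ j′ → j ≤ j′ × p j′ ≢ x}
      ... | no stays = x , j , λ j′ j≤j′ →
            decidable-stable (p j′ ≟ᶠ x) (λ ne → stays (j′ , j≤j′ , ne))
      ... | yes (j′ , j≤j′ , ne) with descending-≤′ desc (≤⇒≤′ j≤j′)
      ...   | inj₁ e = ⊥-elim (ne (trans e pj≡x))
      ...   | inj₂ l = go (p j′) (rs (subst (p j′ ≺_) pj≡x l)) j′ refl

uniform-bound : ∀ {B : Set} (Q : B → ℕ → Set) → (∀ b {n m} → n ≤ m → Q b n → Q b m) →
  (xs : List B) → (∀ b → b ∈ᴸ xs → Σ ℕ (Q b)) → Σ ℕ λ n → ∀ b → b ∈ᴸ xs → Q b n
uniform-bound Q up [] h = 0 , λ b ()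
uniform-bound Q up (x ∷ xs) h with h x (here refl) | uniform-bound Q up xs (λ b b∈ → h b (there b∈))
... | n , qx | m , qxs = n ⊔ m , λ { b (here refl) → up b (m≤m⊔n n m) qx
                                   ; b (there b∈) → up b (m≤n⊔m n m) (qxs b b∈) }

τ*-snoc : ∀ {nI nO nT} (M : Moore nI nO nT) t w d → τ* M t (w ∷ʳ d) ≡ Moore.τ M (τ* M t w) d
τ*-snoc M t [] d = refl
τ*-snoc M t (x ∷ w) d = τ*-snoc M (Moore.τ M t x) w d

module Automaton {nI nO nQ : ℕ} (em : ExcludedMiddle 0ℓ) (A : AHTA nI nO nQ) where
  open AHTA A
  open Classical em

  RankRel : Kind → Bool → ℕ → ℕ → Set
  RankRel N true  r r′ = ⊤
  RankRel N false r r′ = r > r′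
  RankRel U true  r r′ = r > r′
  RankRel U false r r′ = r ≥ r′

  rankCond-intro : ∀ q q′ {r r′} → (part q ≡ part q′ → RankRel (kind (part q)) (acc q) r r′) →
                   rankCond A q q′ r r′
  rankCond-intro q q′ rel with part q ≟ᶠ part q′
  ... | no _ = tt
  ... | yes same with kind (part q) | acc q | rel same
  ...   | N | true  | x = x
  ...   | N | false | x = x
  ...   | U | true  | x = x
  ...   | U | false | x = x

  rankCond-elim : ∀ q q′ {r r′} → part q ≡ part q′ → rankCond A q q′ r r′ →
                  RankRel (kind (part q)) (acc q) r r′
  rankCond-elim q q′ same cond with part q ≟ᶠ part q′
  ... | no differ = ⊥-elim (differ same)
  ... | yes _ with kind (part q) | acc q
  ...   | N | true  = cond
  ...   | N | false = cond
  ...   | U | true  = cond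
  ...   | U | false = cond

  Ranked : (ℕ → Fin nQ) → (ℕ → ℕ) → Set
  Ranked s r = ∀ j → (part (s (suc j)) ≡ part (s j) ⊎ part (s (suc j)) ≺ part (s j))
                   × rankCond A (s j) (s (suc j)) (r j) (r (suc j))

  -- Ranked sequences are accepting: the set stabilises, and then the ranks bound the
  -- visits to Acc (universal set) resp. the gaps between them (nondeterministic set).
  ranked-accepting : ∀ s r → Ranked s r → AccSeq A s
  ranked-accepting s r ranked
    with eventually-constant ≺-spo (λ j → part (s j)) (λ j → proj₁ (ranked j))
  ... | i , m , stable = byKind (kind i) refl
    where
    rel : ∀ {κ} → kind i ≡ κ → ∀ j → m ≤ j → RankRel κ (acc (s j)) (r j) (r (suc j))
    rel refl j m≤j = subst (λ x → RankRel (kind x) (acc (s j)) (r j) (r (suc j))) (stable j m≤j)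
      (rankCond-elim (s j) (s (suc j))
        (trans (stable j m≤j) (sym (stable (suc j) (m≤n⇒m≤1+n m≤j)))) (proj₂ (ranked j)))

    byKind : ∀ κ → kind i ≡ κ → AccSeq A s
    byKind U kU with finitely-many-drops r (λ j → acc (s j) ≡ true) m noninc drop
      where
      noninc : ∀ j → m ≤ j → r (suc j) ≤ r j
      noninc j m≤j with acc (s j) | rel kU j m≤j
      ... | true  | r′<r = <⇒≤ r′<r
      ... | false | r′≤r = r′≤r
      drop : ∀ j → m ≤ j → acc (s j) ≡ true → r (suc j) < r j
      drop j m≤j a = subst (λ b → RankRel U b (r j) (r (suc j))) a (rel kU j m≤j)
    ... | m′ , rejecting = inj₁ ((i , kU , m , stable) , m′ , λ j m′≤j (a , _) → rejecting j m′≤j a)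
    byKind N kN = inj₂ ((i , kN , m , stable) , visits)
      where
      drop : ∀ j → m ≤ j → ¬ acc (s j) ≡ true → r (suc j) < r j
      drop j m≤j ¬a with acc (s j) | rel kN j m≤j
      ... | true  | _ = ⊥-elim (¬a refl)
      ... | false | r′<r = r′<r
      visits : InfinitelyOften (λ j → acc (s j) ≡ true × kind (part (s j)) ≡ N)
      visits m′ with infinitely-many-rests r (λ j → acc (s j) ≡ true) m drop (m ⊔ m′)
      ... | j , le , a = j , ≤-trans (m≤n⊔m m m′) le , a ,
                         trans (cong kind (stable j (≤-trans (m≤m⊔n m m′) le))) kN

  accepting-suffix : ∀ {s s′} L → (∀ j → s (L + j) ≡ s′ j) → AccSeq A s → AccSeq A s′
  accepting-suffix {s} {s′} L shift (inj₁ ((i , kU , stays) , rejecting)) =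
    inj₁ ((i , kU , eventually-suffix {λ q → part q ≡ i} stays) ,
          eventually-suffix {λ q → ¬ (acc q ≡ true × kind (part q) ≡ U)} rejecting)
    where
    eventually-suffix : ∀ {P : Fin nQ → Set} → Eventually (λ j → P (s j)) → Eventually (λ j → P (s′ j))
    eventually-suffix {P} (m , ev) = m , λ j m≤j → subst P (shift j) (ev (L + j) (≤-trans m≤j (m≤n+m j L)))
  accepting-suffix {s} {s′} L shift (inj₂ ((i , kN , m , stable) , visits)) =
    inj₂ ((i , kN , m , λ j m≤j → subst (λ q → part q ≡ i) (shift j) (stable (L + j) (≤-trans m≤j (m≤n+m j L)))) ,
          λ m′ → later m′ (visits (L + m′)))
    where
    later : ∀ m′ → (Σ ℕ λ j → L + m′ ≤ j × acc (s j) ≡ true × kind (part (s j)) ≡ N) →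
            Σ ℕ λ j → m′ ≤ j × acc (s′ j) ≡ true × kind (part (s′ j)) ≡ N
    later m′ (j , L+m′≤j , visit) = j ∸ L ,
      subst (_≤ j ∸ L) (m+n∸m≡n L m′) (∸-monoˡ-≤ L L+m′≤j) ,
      subst (λ q → acc q ≡ true × kind (part q) ≡ N)
            (trans (sym (cong s (m+[n∸m]≡n (≤-trans (m≤m+n L m′) L+m′≤j)))) (shift (j ∸ L))) visit

  private
    N≢U : N ≢ U
    N≢U ()

  N-set-visits-Acc : ∀ {s} → AccSeq A s → ∀ i → kind i ≡ N → (∀ j → part (s j) ≡ i) →
                     ¬ (∀ j → acc (s j) ≡ false)
  N-set-visits-Acc (inj₁ ((i′ , kU , m , stable) , _)) i kN inI _ =
    N≢U (trans (sym kN) (trans (cong kind (trans (sym (inI m)) (stable m ≤-refl))) kU))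
  N-set-visits-Acc (inj₂ (_ , visits)) i kN inI rejecting with visits 0
  ... | j , _ , a , _ with trans (sym a) (rejecting j)
  ...   | ()

  U-set-avoids-Acc : ∀ {s} → AccSeq A s → ∀ i → kind i ≡ U → (∀ j → part (s j) ≡ i) →
                     ¬ InfinitelyOften (λ j → acc (s j) ≡ true)
  U-set-avoids-Acc (inj₂ ((i′ , kN , m , stable) , _)) i kU inI _ =
    N≢U (trans (sym kN) (trans (cong kind (trans (sym (stable m ≤-refl)) (inI m))) kU))
  U-set-avoids-Acc (inj₁ (_ , m , rejecting)) i kU inI visits with visits m
  ... | j , m≤j , a = rejecting j m≤j (a , trans (cong kind (inI j)) kU)

-- Run nodes are pairs (tree node n, state q) with rch(q, τ*(t₀,n)); the children of
-- (n,q) are the atoms chosen by the query's proof of δ(q, out t).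
module Soundness {nI nO nT nQ : ℕ} (em : ExcludedMiddle 0ℓ) (M : Moore nI nO nT) (A : AHTA nI nO nQ)
                 (sol : SMTSat M A) where
  open Moore M
  open AHTA A
  open Automaton em A

  rch : Fin nQ → Fin nT → Bool
  rch = proj₁ sol

  ρ : Fin nQ → Fin nT → ℕ
  ρ = proj₁ (proj₂ sol)

  -- What the query demands of an atom (d,q′) in δ(q, out t), together with what the
  -- hesitant structure guarantees: the target set is not above that of q.
  Succ : Fin nQ → Fin nT → Subset nI × Fin nQ → Set
  Succ q t (d , q′) = (rch q′ (τ t d) ≡ true × rankCond A q q′ (ρ q t) (ρ q′ (τ t d)))
                    × SameOrLower part _≺_ (part q) (d , q′)

  succ-sat : ∀ q t → rch q t ≡ true → ⟦ δ q (out t) ⟧ᵇ (Succ q t)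
  succ-sat q t r = ⟦⟧ᵇ-mono (δ q (out t)) (λ { (d , q′) v → v })
    (⟦⟧ᵇ-restrict (δ q (out t))
      (hes-atoms part _≺_ (part q) (kind (part q)) (δ q (out t)) (hesitant q (out t)))
      (proj₂ (proj₂ (proj₂ sol)) q t r))

  RunNode : Set
  RunNode = Σ (List (Subset nI)) λ n → Σ (Fin nQ) λ q → rch q (τ* M t₀ n) ≡ true

  position : RunNode → Fin nT
  position (n , _) = τ* M t₀ n

  stateOf : RunNode → Fin nQ
  stateOf (_ , q , _) = q

  child : ∀ n q → Σ _ (Succ q (τ* M t₀ n)) → RunNode
  child n q ((d , q′) , (r′ , _) , _) = n ∷ʳ d , q′ , subst (λ t → rch q′ t ≡ true) (sym (τ*-snoc M t₀ n d)) r′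

  children : RunNode → List RunNode
  children (n , q , r) = map (child n q) (chosen (δ q (out (τ* M t₀ n))) (succ-sat q _ r))

  run : RunTree A (compTree M)
  run = record
    { R = RunNode ; root = [] , q₀ , proj₁ (proj₂ (proj₂ sol))
    ; node = proj₁ ; state = stateOf ; children = children
    ; root-node = refl ; root-state = refl
    ; child-dir = child-dir ; sat = sat }
    where
    child-dir : ∀ x c → c ∈ᴸ children x → Σ (Subset nI) λ d → proj₁ c ≡ proj₁ x ∷ʳ d
    child-dir (n , q , r) c c∈ with ∈-map⁻ (child n q) c∈
    ... | ((d , _) , _) , _ , refl = d , refl
    sat : ∀ x → ⟦ δ (stateOf x) (compTree M (proj₁ x)) ⟧ᵇ
                  (λ { (d , q′) → Any (λ c → proj₁ c ≡ proj₁ x ∷ʳ d × stateOf c ≡ q′) (children x) })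
    sat (n , q , r) = ⟦⟧ᵇ-mono (δ q (out (τ* M t₀ n)))
      (λ { (d , q′) a → Any.map⁺ (Any-map (λ { {(_ , _) , _} refl → refl , refl }) a) })
      (chosen-sat (δ q (out (τ* M t₀ n))) (succ-sat q _ r))

  edge : ∀ x c → c ∈ᴸ children x →
         (part (stateOf c) ≡ part (stateOf x) ⊎ part (stateOf c) ≺ part (stateOf x))
         × rankCond A (stateOf x) (stateOf c) (ρ (stateOf x) (position x)) (ρ (stateOf c) (position c))
  edge (n , q , r) c c∈ with ∈-map⁻ (child n q) c∈
  ... | ((d , q′) , (_ , cond) , lower) , _ , refl =
    lower , subst (λ t → rankCond A q q′ (ρ q (τ* M t₀ n)) (ρ q′ t)) (sym (τ*-snoc M t₀ n d)) cond

  accepts : Accepts A (compTree M)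
  accepts = run , λ π path → ranked-accepting (λ j → stateOf (π j)) (λ j → ρ (stateOf (π j)) (position (π j)))
                                               (λ j → edge (π j) (π (suc j)) (proj₂ path j))

-- In a nondeterministic
-- set the rank of (q,t) is the least n such that some run node at (q,t) reaches Acc within
-- n steps along the run; in a universal set it is a co-Büchi rank of the position.
module Completeness {nI nO nT nQ : ℕ} (em : ExcludedMiddle 0ℓ) (M : Moore nI nO nT) (A : AHTA nI nO nQ)
                    (accepting : Accepts A (compTree M)) where
  open Moore M
  open AHTA A
  open Automaton em A
  open Classical em
  open RunTree (proj₁ accepting)

  pos : R → Fin nT
  pos y = τ* M t₀ (node y)

  child-pos : ∀ {x c d} → node c ≡ node x ∷ʳ d → pos c ≡ τ (pos x) d
  child-pos {x} {c} {d} e = trans (cong (τ* M t₀) e) (τ*-snoc M t₀ (node x) d)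

  data Reach : R → Set where
    root-reach  : Reach root
    child-reach : ∀ {x c} → Reach x → c ∈ᴸ children x → Reach c

  Occupied : Fin nQ → Fin nT → Set
  Occupied q t = Σ R λ y → Reach y × state y ≡ q × pos y ≡ t

  PathFrom : R → (ℕ → R) → Set
  PathFrom y g = g 0 ≡ y × ∀ j → g (suc j) ∈ᴸ children (g j)

  root-path : ∀ {y g} → Reach y → PathFrom y g →
              Σ (ℕ → R) λ π → IsPath π × Σ ℕ λ L → ∀ j → π (L + j) ≡ g j
  root-path root-reach path = _ , path , 0 , λ j → refl
  root-path {g = g} (child-reach {x} rx c∈) (g0≡c , steps) with root-path rx (refl , steps′)
    where
    prepend : ℕ → R
    prepend zero = x
    prepend (suc j) = g j
    steps′ : ∀ j → prepend (suc j) ∈ᴸ children (prepend j)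
    steps′ zero = subst (_∈ᴸ children x) (sym g0≡c) c∈
    steps′ (suc j) = steps j
  ... | π , isPath , L , shift = π , isPath , suc L , λ j → trans (cong π (sym (+-suc L j))) (shift (suc j))

  path-accepting : ∀ {y g} → Reach y → PathFrom y g → AccSeq A (λ j → state (g j))
  path-accepting ry path with root-path ry path
  ... | π , isPath , L , shift = accepting-suffix L (λ j → cong state (shift j)) (proj₂ accepting π isPath)

  -- Finite walks down the run through nodes satisfying P (the start node excepted).
  data Walk (P : R → Set) : R → R → Set where
    stop : ∀ {z} → Walk P z z
    step : ∀ {z c w} → c ∈ᴸ children z → P c → Walk P c w → Walk P z w

  walk-snoc : ∀ {P z w c} → Walk P z w → c ∈ᴸ children w → P c → Walk P z c
  walk-snoc stop c∈ pc = step c∈ pc stop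
  walk-snoc (step c∈ pc walk) c′∈ pc′ = step c∈ pc (walk-snoc walk c′∈ pc′)

  walk-end : ∀ {P z w} → P z → Walk P z w → P w
  walk-end pz stop = pz
  walk-end pz (step _ pc walk) = walk-end pc walk

  walk-length : ∀ {P z w} → Walk P z w → ℕ
  walk-length stop = 0
  walk-length (step _ _ walk) = suc (walk-length walk)

  büchi-path : (P F : R → Set) → (∀ z → P z → Σ R λ c → c ∈ᴸ children z × P c) →
    (∀ z → P z → Σ R λ w → Walk P z w × F w) →
    ∀ y → P y → Σ (ℕ → R) λ g → PathFrom y g × (∀ j → P (g j)) × InfinitelyOften (λ j → F (g j))
  büchi-path P F P-child reach-F y py =
    (λ j → proj₁ (run j)) , (refl , run-step start) , (λ j → proj₁ (proj₂ (run j))) , visits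
    where
    -- a P-node together with a pending walk to an F-node
    State : Set
    State = Σ R λ z → P z × Σ R λ w → Walk P z w × F w

    restart : (Σ R λ c → P c) → State
    restart (c , pc) = c , pc , reach-F c pc

    next : State → State
    next (_ , _ , w , step {c = c} _ pc walk , fw) = c , pc , w , walk , fw
    next (z , pz , _ , stop , _) = restart (proj₁ (P-child z pz) , proj₂ (proj₂ (P-child z pz)))

    next-child : ∀ x → proj₁ (next x) ∈ᴸ children (proj₁ x)
    next-child (_ , _ , _ , step c∈ _ _ , _) = c∈
    next-child (z , pz , _ , stop , _) = proj₁ (proj₂ (P-child z pz))

    iterate : State → ℕ → State
    iterate x zero = x
    iterate x (suc j) = iterate (next x) j

    start : State
    start = restart (y , py)

    run : ℕ → State
    run = iterate start

    run-step : ∀ x j → proj₁ (iterate x (suc j)) ∈ᴸ children (proj₁ (iterate x j))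
    run-step x zero = next-child x
    run-step x (suc j) = run-step (next x) j

    iterate-+ : ∀ x m n → iterate x (m + n) ≡ iterate (iterate x m) n
    iterate-+ x zero n = refl
    iterate-+ x (suc m) n = iterate-+ (next x) m n

    pending : State → ℕ
    pending (_ , _ , _ , walk , _) = walk-length walk

    F-after-pending : ∀ n x → pending x ≡ n → F (proj₁ (iterate x n))
    F-after-pending zero (_ , _ , _ , stop , fz) _ = fz
    F-after-pending (suc n) (_ , _ , w , step _ pc walk , fw) e = F-after-pending n (_ , pc , w , walk , fw) (suc-injective e)

    visits : InfinitelyOften (λ j → F (proj₁ (run j)))
    visits m = m + pending (run m) , m≤m+n m _ ,
      subst (λ x → F (proj₁ x)) (sym (iterate-+ start m _)) (F-after-pending _ (run m) refl)

  Picked : R → (R → Set) → Subset nI × Fin nQ → Set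
  Picked y P (d , q′) =
    Any (λ c → node c ≡ node y ∷ʳ d × state c ≡ q′ × (part q′ ≡ part (state y) → P c)) (children y)

  Picks : R → (R → Set) → Set
  Picks y P = ⟦ δ (state y) (out (pos y)) ⟧ᵇ (Picked y P)

  picks-mono : ∀ y {P P′ : R → Set} → (∀ c → P c → P′ c) → Picks y P → Picks y P′
  picks-mono y f = ⟦⟧ᵇ-mono (δ (state y) (out (pos y)))
    (λ { (d , q′) → Any-map (λ { (e , e′ , p) → e , e′ , λ same → f _ (p same) }) })

  picks-all : ∀ y {P : R → Set} → (∀ c → c ∈ᴸ children y → part (state c) ≡ part (state y) → P c) → Picks y P
  picks-all y f = ⟦⟧ᵇ-mono (δ (state y) (out (pos y)))
    (λ { (d , q′) a → let c , c∈ , ce = find a in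
                      lose c∈ (proj₁ ce , proj₂ ce , λ same → f c c∈ (trans (cong part (proj₂ ce)) same)) })
    (sat y)

  Target : Fin nQ → Fin nT → (Fin nQ → Fin nT → Set) → Subset nI × Fin nQ → Set
  Target q t Q (d , q′) = Occupied q′ (τ t d) × (part q′ ≡ part q → Q q′ (τ t d))

  -- (A record, so that Q can be inferred from the type.)
  record Move (q : Fin nQ) (t : Fin nT) (Q : Fin nQ → Fin nT → Set) : Set where
    constructor move
    field moves : ⟦ δ q (out t) ⟧ᵇ (Target q t Q)

  move-mono : ∀ {q t} {Q Q′ : Fin nQ → Fin nT → Set} → (∀ q′ t′ → Q q′ t′ → Q′ q′ t′) → Move q t Q → Move q t Q′
  move-mono {q} {t} f (move m) = move (⟦⟧ᵇ-mono (δ q (out t)) (λ { (d , q′) (occ , x) → occ , λ same → f _ _ (x same) }) m)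

  picks→move : ∀ y → Reach y → {P : R → Set} {Q : Fin nQ → Fin nT → Set} →
    (∀ c → c ∈ᴸ children y → P c → Q (state c) (pos c)) → Picks y P → Move (state y) (pos y) Q
  picks→move y ry {P} {Q} f p = move (⟦⟧ᵇ-mono (δ (state y) (out (pos y))) realise p)
    where
    realise : ∀ s → Picked y P s → Target (state y) (pos y) Q s
    realise (d , q′) a with find a
    ... | c , c∈ , e , e′ , x =
      (c , child-reach ry c∈ , e′ , child-pos e) , λ same → subst₂ Q e′ (child-pos e) (f c c∈ (x same))

  move-of : ∀ y → Reach y → {Q : Fin nQ → Fin nT → Set} →
    (∀ c → c ∈ᴸ children y → part (state c) ≡ part (state y) → Q (state c) (pos c)) →
    Move (state y) (pos y) Q
  move-of y ry {Q} f = picks→move y ry {Q = Q} (λ c c∈ q → q) (picks-all y f)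

  -- Nondeterministic sets.  Chain n y: every choice of the run inside y's set starting at y
  -- meets Acc within n steps.
  mutual
    Chain : ℕ → R → Set
    Chain n y = acc (state y) ≡ true ⊎ Picks y (ChainBelow n)

    ChainBelow : ℕ → R → Set
    ChainBelow zero    c = ⊥
    ChainBelow (suc n) c = Chain n c

  mutual
    chain-suc : ∀ n y → Chain n y → Chain (suc n) y
    chain-suc n y (inj₁ a) = inj₁ a
    chain-suc n y (inj₂ p) = inj₂ (picks-mono y (chainBelow-suc n) p)

    chainBelow-suc : ∀ n c → ChainBelow n c → ChainBelow (suc n) c
    chainBelow-suc (suc n) c ch = chain-suc n c ch

  chain-mono : ∀ {n m} y → n ≤′ m → Chain n y → Chain m y
  chain-mono y ≤′-refl ch = ch
  chain-mono y (≤′-step n≤′m) ch = chain-suc _ y (chain-mono y n≤′m ch)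

  module NondeterministicSet (i : Fin k) where

    Unchained : R → Set
    Unchained z = Reach z × part (state z) ≡ i × ¬ Σ ℕ (λ n → Chain n z)

    unchained-rejecting : ∀ z → Unchained z → acc (state z) ≡ false
    unchained-rejecting z (_ , _ , none) = ¬-not λ a → none (0 , inj₁ a)

    -- An unchained node has an unchained same-set child: otherwise one plus the longest
    -- chain of its same-set children would chain it.
    unchained-child : ∀ z → Unchained z → Σ R λ c → c ∈ᴸ children z × Unchained c
    unchained-child z (rz , zi , none) with em {Σ R λ c → c ∈ᴸ children z × Unchained c}
    ... | yes found = found
    ... | no noChild = ⊥-elim (none (suc b , inj₂ (picks-all z λ c c∈ same → bounded c c∈ (trans same zi))))
      where
      chained : ∀ c → c ∈ᴸ children z → Σ ℕ λ n → part (state c) ≡ i → Chain n c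
      chained c c∈ with em {Σ ℕ (λ n → Chain n c)}
      ... | yes (n , ch) = n , λ _ → ch
      ... | no unchained = 0 , λ ci → ⊥-elim (noChild (c , c∈ , child-reach rz c∈ , ci , unchained))
      bound : Σ ℕ λ b → ∀ c → c ∈ᴸ children z → part (state c) ≡ i → Chain b c
      bound = uniform-bound (λ c n → part (state c) ≡ i → Chain n c)
                (λ c n≤m ch ci → chain-mono c (≤⇒≤′ n≤m) (ch ci)) (children z) chained
      b = proj₁ bound
      bounded = proj₂ bound

  -- Every reachable node in a nondeterministic set has a chain: otherwise an infinite path
  -- of unchained nodes stays in the set and avoids Acc.
  chain-exists : ∀ y → Reach y → kind (part (state y)) ≡ N → Σ ℕ λ n → Chain n y
  chain-exists y ry kN with em {Σ ℕ λ n → Chain n y}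
  ... | yes ch = ch
  ... | no none
    with büchi-path Unchained (λ _ → ⊤) unchained-child (λ z _ → z , stop , tt) y (ry , refl , none)
    where open NondeterministicSet (part (state y))
  ... | g , path , unchained , _ = ⊥-elim (N-set-visits-Acc (path-accepting ry path) (part (state y)) kN
          (λ j → proj₁ (proj₂ (unchained j))) (λ j → unchained-rejecting (g j) (unchained j)))
    where open NondeterministicSet (part (state y))

  -- Z n q t holds iff (q,t) lies in a set S of
  -- positions (a characteristic function, so that Z lives in Set) each of whose members
  -- moves into S if rejecting and strictly below rank n if accepting.
  mutual
    Z : ℕ → Fin nQ → Fin nT → Set
    Z n q t = Σ (Fin nQ → Fin nT → Bool) λ S → S q t ≡ true × Closed n S

    Closed : ℕ → (Fin nQ → Fin nT → Bool) → Set
    Closed n S = ∀ q t → S q t ≡ true → (acc q ≡ true → Move q t (ZBelow n))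
                                      × (acc q ≡ false → Move q t (λ q′ t′ → S q′ t′ ≡ true))

    ZBelow : ℕ → Fin nQ → Fin nT → Set
    ZBelow zero    q t = ⊥
    ZBelow (suc n) q t = Z n q t

  Z-step : ∀ n q t → Z n q t → (acc q ≡ true → Move q t (ZBelow n)) × (acc q ≡ false → Move q t (Z n))
  Z-step n q t (S , s , closed) =
    proj₁ (closed q t s) , λ r → move-mono (λ q′ t′ s′ → S , s′ , closed) (proj₂ (closed q t s) r)

  mutual
    Z-suc : ∀ n q t → Z n q t → Z (suc n) q t
    Z-suc n q t (S , s , closed) = S , s , λ q′ t′ s′ →
      (λ a → move-mono (ZBelow-suc n) (proj₁ (closed q′ t′ s′) a)) , proj₂ (closed q′ t′ s′)

    ZBelow-suc : ∀ n q t → ZBelow n q t → ZBelow (suc n) q t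
    ZBelow-suc (suc n) q t z = Z-suc n q t z

  ZBelow⇒Z : ∀ n q t → ZBelow n q t → Z n q t
  ZBelow⇒Z (suc n) q t z = Z-suc n q t z

  Z-mono : ∀ {n m} q t → n ≤′ m → Z n q t → Z m q t
  Z-mono q t ≤′-refl z = z
  Z-mono q t (≤′-step n≤′m) z = Z-suc _ q t (Z-mono q t n≤′m z)

  Z-coinduction : ∀ n (Q : Fin nQ → Fin nT → Set) →
    (∀ q t → Q q t → (acc q ≡ true → Move q t (Z n))
                   × (acc q ≡ false → Move q t (λ q′ t′ → Z n q′ t′ ⊎ Q q′ t′))) →
    ∀ q t → Q q t → Z (suc n) q t
  Z-coinduction n Q moves q t x = S , holds-complete (inj₂ x) , closed
    where
    S : Fin nQ → Fin nT → Bool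
    S q′ t′ = holds (Z n q′ t′ ⊎ Q q′ t′)
    into-S : ∀ q′ t′ → Z n q′ t′ ⊎ Q q′ t′ → S q′ t′ ≡ true
    into-S q′ t′ = holds-complete
    closed : Closed (suc n) S
    closed q′ t′ s′ with holds-sound {Z n q′ t′ ⊎ Q q′ t′} s′
    ... | inj₁ z = (λ a → move-mono (ZBelow⇒Z n) (proj₁ (Z-step n q′ t′ z) a)) ,
                   (λ r → move-mono (λ a b z′ → into-S a b (inj₁ z′)) (proj₂ (Z-step n q′ t′ z) r))
    ... | inj₂ x′ = proj₁ (moves q′ t′ x′) , λ r → move-mono into-S (proj₂ (moves q′ t′ x′) r)

  CoBüchiRanked : Fin nQ → Fin nT → Set
  CoBüchiRanked q t = Σ ℕ λ n → Z n q t

  Z-bound : Σ ℕ λ b → ∀ q t → CoBüchiRanked q t → Z b q t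
  Z-bound with uniform-bound (λ { (q , t) n → CoBüchiRanked q t → Z n q t })
                 (λ { (q , t) n≤m z r → Z-mono q t (≤⇒≤′ n≤m) (z r) })
                 (cartesianProduct (allFin nQ) (allFin nT)) (λ { (q , t) _ → ranked q t })
    where
    ranked : ∀ q t → Σ ℕ λ n → CoBüchiRanked q t → Z n q t
    ranked q t with em {CoBüchiRanked q t}
    ... | yes (n , z) = n , λ _ → z
    ... | no unranked = 0 , λ r → ⊥-elim (unranked r)
  ... | b , bounded = b , λ q t → bounded (q , t) (∈-cartesianProduct⁺ (∈-allFin q) (∈-allFin t))

  module UniversalSet (i : Fin k) where

    b : ℕ
    b = proj₁ Z-bound

    Unranked : R → Set
    Unranked z = Reach z × part (state z) ≡ i × ¬ CoBüchiRanked (state z) (pos z)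

    moves-into : ∀ z → Reach z → part (state z) ≡ i → (Q : Fin nQ → Fin nT → Set) →
      (∀ c → c ∈ᴸ children z → Unranked c → Q (state c) (pos c)) →
      Move (state z) (pos z) (λ q t → Z b q t ⊎ Q q t)
    moves-into z rz zi Q unranked = move-of z rz λ c c∈ same →
      case em {CoBüchiRanked (state c) (pos c)} of λ where
        (yes r) → inj₁ (proj₂ Z-bound _ _ r)
        (no ¬r) → inj₂ (unranked c c∈ (child-reach rz c∈ , trans same zi , ¬r))

    -- An unranked node has an unranked same-set child, or its position would have rank b + 1.
    unranked-child : ∀ z → Unranked z → Σ R λ c → c ∈ᴸ children z × Unranked c
    unranked-child z (rz , zi , ¬r) with em {Σ R λ c → c ∈ᴸ children z × Unranked c}
    ... | yes found = found
    ... | no noChild = ⊥-elim (¬r (suc b , Z-coinduction b At moves (state z) (pos z) (refl , refl)))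
      where
      At : Fin nQ → Fin nT → Set
      At q t = q ≡ state z × t ≡ pos z
      into-Z : Move (state z) (pos z) (Z b)
      into-Z = move-mono (λ q t → [ (λ z′ → z′) , ⊥-elim ]′)
                 (moves-into z rz zi (λ _ _ → ⊥) (λ c c∈ u → noChild (c , c∈ , u)))
      moves : ∀ q t → At q t → (acc q ≡ true → Move q t (Z b)) × (acc q ≡ false → Move q t (λ q′ t′ → Z b q′ t′ ⊎ At q′ t′))
      moves q t (refl , refl) = (λ _ → into-Z) , (λ _ → move-mono (λ _ _ → inj₁) into-Z)

    -- An unranked node reaches Acc through unranked nodes, or the positions of all its
    -- unranked descendants would have rank b + 1.
    unranked-reaches-Acc : ∀ c → Unranked c → Σ R λ w → Walk Unranked c w × acc (state w) ≡ true
    unranked-reaches-Acc c uc with em {Σ R λ w → Walk Unranked c w × acc (state w) ≡ true}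
    ... | yes found = found
    ... | no never = ⊥-elim (proj₂ (proj₂ uc) (suc b , Z-coinduction b Below moves (state c) (pos c) (c , stop , refl , refl)))
      where
      Below : Fin nQ → Fin nT → Set
      Below q t = Σ R λ w → Walk Unranked c w × state w ≡ q × pos w ≡ t
      moves : ∀ q t → Below q t → (acc q ≡ true → Move q t (Z b)) × (acc q ≡ false → Move q t (λ q′ t′ → Z b q′ t′ ⊎ Below q′ t′))
      moves q t (w , walk , refl , refl) = (λ a → ⊥-elim (never (w , walk , a))) , λ _ →
        moves-into w (proj₁ uw) (proj₁ (proj₂ uw)) Below (λ c′ c′∈ uc′ → c′ , walk-snoc walk c′∈ uc′ , refl , refl)
        where
        uw = walk-end uc walk

  -- Every reachable node in a universal set has a ranked position: otherwise an infinite
  -- path of unranked nodes stays in the set and visits Acc infinitely often.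
  coBüchi-ranked : ∀ y → Reach y → kind (part (state y)) ≡ U → CoBüchiRanked (state y) (pos y)
  coBüchi-ranked y ry kU with em {CoBüchiRanked (state y) (pos y)}
  ... | yes r = r
  ... | no ¬r
    with büchi-path Unranked (λ w → acc (state w) ≡ true) unranked-child unranked-reaches-Acc y (ry , refl , ¬r)
    where open UniversalSet (part (state y))
  ... | g , path , unranked , visits = ⊥-elim (U-set-avoids-Acc (path-accepting ry path) (part (state y)) kU
          (λ j → proj₁ (proj₂ (unranked j))) visits)
    where open UniversalSet (part (state y))

  rch : Fin nQ → Fin nT → Bool
  rch q t = holds (Occupied q t)

  RankWitness : Kind → Fin nQ → Fin nT → ℕ → Set
  RankWitness N q t n = Σ R λ y → Reach y × state y ≡ q × pos y ≡ t × Chain n y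
  RankWitness U q t n = Z n q t

  HasRank : Fin nQ → Fin nT → ℕ → Set
  HasRank q t = RankWitness (kind (part q)) q t

  as-rank : ∀ {κ} q t n → kind (part q) ≡ κ → RankWitness κ q t n → HasRank q t n
  as-rank q t n kq w = subst (λ κ → RankWitness κ q t n) (sym kq) w

  ρ : Fin nQ → Fin nT → ℕ
  ρ q t = minimum (HasRank q t)

  occupied-ranked : ∀ q t → Occupied q t → Σ ℕ (HasRank q t)
  occupied-ranked q t (y , ry , refl , refl) = by-kind (kind (part (state y))) refl
    where
    by-kind : ∀ κ → kind (part (state y)) ≡ κ → Σ ℕ (HasRank (state y) (pos y))
    by-kind N kN with chain-exists y ry kN
    ... | n , ch = n , as-rank _ _ n kN (y , ry , refl , refl , ch)
    by-kind U kU with coBüchi-ranked y ry kU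
    ... | n , z = n , as-rank _ _ n kU z

  RankedBelow : Kind → ℕ → Fin nQ → Fin nT → Set
  RankedBelow κ n q t = Σ ℕ λ m → m < n × RankWitness κ q t m

  chainBelow-ranked : ∀ n c → Reach c → ChainBelow n c → RankedBelow N n (state c) (pos c)
  chainBelow-ranked (suc m) c rc ch = m , ≤-refl , c , rc , refl , refl , ch

  ZBelow-ranked : ∀ n q t → ZBelow n q t → RankedBelow U n q t
  ZBelow-ranked (suc m) q t z = m , ≤-refl , z

  rank-≤ : ∀ {κ} q → kind (part q) ≡ κ → ∀ q′ t′ m → part q′ ≡ part q → RankWitness κ q′ t′ m → ρ q′ t′ ≤ m
  rank-≤ q kq q′ t′ m same w = minimum-≤ (HasRank q′ t′) m (as-rank q′ t′ m (trans (cong kind same) kq) w)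

  rank-< : ∀ {κ} q → kind (part q) ≡ κ → ∀ {n} q′ t′ → part q′ ≡ part q → RankedBelow κ n q′ t′ → ρ q′ t′ < n
  rank-< q kq q′ t′ same (m , m<n , w) = ≤-<-trans (rank-≤ q kq q′ t′ m same w) m<n

  Query : Fin nQ → Fin nT → Subset nI × Fin nQ → Set
  Query q t (d , q′) = rch q′ (τ t d) ≡ true × rankCond A q q′ (ρ q t) (ρ q′ (τ t d))

  satisfies : ∀ q t {κ b} → kind (part q) ≡ κ → acc q ≡ b → {Q : Fin nQ → Fin nT → Set} →
    (∀ q′ t′ → part q′ ≡ part q → Q q′ t′ → RankRel κ b (ρ q t) (ρ q′ t′)) →
    Move q t Q → ⟦ δ q (out t) ⟧ᵇ (Query q t)
  satisfies q t kq aq ranked (move m) = ⟦⟧ᵇ-mono (δ q (out t))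
    (λ { (d , q′) (occ , x) → holds-complete occ , rankCond-intro q q′ λ same →
           subst₂ (λ κ b → RankRel κ b _ _) (sym kq) (sym aq) (ranked q′ _ (sym same) (x (sym same))) })
    m

  constraint-N : ∀ y → Reach y → kind (part (state y)) ≡ N → ∀ b → acc (state y) ≡ b →
    Chain (ρ (state y) (pos y)) y → ⟦ δ (state y) (out (pos y)) ⟧ᵇ (Query (state y) (pos y))
  constraint-N y ry kN true ay _ =
    satisfies _ _ kN ay (λ _ _ _ _ → tt) (move-of y ry {λ _ _ → ⊤} (λ _ _ _ → tt))
  constraint-N y ry kN false ay (inj₁ ay′) with trans (sym ay′) ay
  ... | ()
  constraint-N y ry kN false ay (inj₂ picks) =
    satisfies _ _ kN ay (rank-< (state y) kN)
      (picks→move y ry (λ c c∈ → chainBelow-ranked _ c (child-reach ry c∈)) picks)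

  constraint-U : ∀ q t → kind (part q) ≡ U → ∀ b → acc q ≡ b → Z (ρ q t) q t →
    ⟦ δ q (out t) ⟧ᵇ (Query q t)
  constraint-U q t kU true aq z =
    satisfies q t kU aq (rank-< q kU) (move-mono (ZBelow-ranked _) (proj₁ (Z-step _ q t z) aq))
  constraint-U q t kU false aq z =
    satisfies q t kU aq (λ q′ t′ same → rank-≤ q kU q′ t′ _ same) (proj₂ (Z-step _ q t z) aq)

  constraint : ∀ q t → rch q t ≡ true → ⟦ δ q (out t) ⟧ᵇ (Query q t)
  constraint q t r = by-kind (kind (part q)) refl
    (minimum-holds (HasRank q t) (occupied-ranked q t (holds-sound r)))
    where
    by-kind : ∀ κ → kind (part q) ≡ κ → HasRank q t (ρ q t) → ⟦ δ q (out t) ⟧ᵇ (Query q t)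
    by-kind N kN w with subst (λ κ → RankWitness κ q t (ρ q t)) kN w
    ... | y , ry , refl , refl , ch = constraint-N y ry kN (acc q) refl ch
    by-kind U kU w = constraint-U q t kU (acc q) refl (subst (λ κ → RankWitness κ q t (ρ q t)) kU w)

  solution : SMTSat M A
  solution = rch , ρ , holds-complete (root , root-reach , root-state , cong (τ* M t₀) root-node) ,
             λ q t r → ⟦⟧ᵇ-mono (δ q (out t)) (λ { (d , q′) x → x }) (constraint q t r)

mainTheorem5 : (∀ {ℓ : Level} → ExcludedMiddle ℓ) →
    ∀ {nI nO nT nQ} (M : Moore nI nO nT) (Φ : SF nI nO) (A : AHTA nI nO nQ) →
    (∀ (tr : Tree nI nO) → Accepts A tr ⇔ (tr ⊨ Φ)) →
    ((compTree M ⊨ Φ) ⇔ SMTSat M A)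
mainTheorem5 em M Φ A correct = mk⇔
  (λ M⊨Φ → Completeness.solution em M A (Equivalence.from (correct (compTree M)) M⊨Φ))
  (λ sol → Equivalence.to (correct (compTree M)) (Soundness.accepts em M A sol))
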